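{- Let $\mathcal S,\mathcal E$ be disjoint graph transformation systems over $\Lambda$, $A$ a regulation automaton of $\langle\mathcal S,\mathcal E\rangle$ with starting state $q_0$, $\mathcal{SE}$ the joint system, and $\langle c,d\rangle$ a pair of graph constraints over $\Lambda$. Then $\mathcal{SE}$ is last-minute correct w.r.t. $\langle c,d\rangle$ if and only if (S) the enriched system $\mathcal S_A$ is correct w.r.t. $\langle c,d\rangle$ and (R') for every transformation sequence $G\Rightarrow^*_{\mathcal{SE}}N\Rightarrow_{\mathcal S_A}H\Rightarrow_{\mathcal E_A}H'$ with $G=\langle G',q_0\rangle$ and $G\models c$, we have $H\models d$.
   Context: Graphs over $\Lambda$: finite directed graphs with node and edge labels in $\Lambda$. Graph constraints are nested graph conditions over the empty graph ($\mathrm{true}$, $\exists(a,c)$ for injective $a$, $\neg$, $\wedge$) with the usual satisfaction via injective morphisms. Rules $\langle L\hookleftarrow K\hookrightarrow R,ac\rangle$ are applied via double-pushout transformations at injective matches satisfying $ac$; a GTS is a finite set of rules; $\Rightarrow^*$, $\Rightarrow^+$ denote sequences of length $\ge0$, $\ge1$. A regulation automaton is $A=\langle Q,q_0,\delta,\mathrm{sel}\rangle$ with finite $Q$ disjoint from $\Lambda$, $q_0\in Q$, $\delta\subseteq Q\times Q$, $\mathrm{sel}:\delta\to\mathcal P(\mathcal S\cup\mathcal E)$. $\langle G,q\rangle$ is $G$ plus a disjoint node labelled $q$. $\mathcal R_A$ ($\mathcal R\in\{\mathcal S,\mathcal E\}$) consists of the rules $\langle\langle L,q\rangle\hookleftarrow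 K\hookrightarrow\langle R,q'\rangle,ac\rangle$ for $\langle L\hookleftarrow K\hookrightarrow R,ac\rangle\in\mathcal R\cap\mathrm{sel}\langle q,q'\rangle$, $\langle q,q'\rangle\in\delta$; the joint system is $\mathcal{SE}=\mathcal S_A\cup\mathcal E_A$, applied to graphs $\langle G',q_0\rangle$ with $G'$ over $\Lambda$; constraints over $\Lambda$ are evaluated directly on such graphs. $\mathcal S_A$ is correct w.r.t. $\langle c,d\rangle$ if for every $G=\langle G',q_0\rangle$ with $G\models c$ and every $H$ with $G\Rightarrow^+_{\mathcal S_A}H$, $H\models d$. $\mathcal{SE}$ is last-minute correct w.r.t. $\langle c,d\rangle$ if (S) holds and (R) for every sequence $G\Rightarrow^*_{\mathcal{SE}}M\Rightarrow_{\mathcal E_A}N\Rightarrow^+_{\mathcal S_A}H\Rightarrow_{\mathcal E_A}H'$ with $G=\langle G',q_0\rangle$, $G\models c$, we have $H\models d$. -}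

module Defs where

open import Data.Nat using (ℕ)
open import Data.Fin using (Fin; zero; suc)
open import Data.Sum using (_⊎_; inj₁; inj₂)
open import Data.Product using (Σ; Σ-syntax; _×_; _,_)
open import Data.Unit using (⊤)
open import Data.Empty using (⊥)
open import Data.Bool using (Bool; true)
open import Data.List using (List)
open import Data.List.Membership.Propositional using (_∈_)
open import Relation.Nullary using (¬_)
open import Relation.Binary.PropositionalEquality using (_≡_; refl; cong; trans)
open import Relation.Binary.Construct.Closure.ReflexiveTransitive using (Star)
open import Relation.Binary.Construct.Closure.Transitive using (TransClosure)
open import Function using (_∘_; id)
open import Function.Definitions using (Injective)

record Graph (Lab : Set) : Set where
  field
    nV nE : ℕ
    src tgt : Fin nE → Fin nV
    lV : Fin nV → Lab
    lE : Fin nE → Lab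
open Graph public

record Hom {Lab : Set} (G H : Graph Lab) : Set where
  field
    fV : Fin (nV G) → Fin (nV H)
    fE : Fin (nE G) → Fin (nE H)
    src-pres : ∀ e → src H (fE e) ≡ fV (src G e)
    tgt-pres : ∀ e → tgt H (fE e) ≡ fV (tgt G e)
    lV-pres : ∀ v → lV H (fV v) ≡ lV G v
    lE-pres : ∀ e → lE H (fE e) ≡ lE G e
open Hom public

module _ {Lab : Set} where

  _≈_ : {G H : Graph Lab} → Hom G H → Hom G H → Set
  f ≈ g = (∀ v → fV f v ≡ fV g v) × (∀ e → fE f e ≡ fE g e)

  _∘H_ : {A B C : Graph Lab} → Hom B C → Hom A B → Hom A C
  _∘H_ {A} {B} {C} g f = record
    { fV = fV g ∘ fV f
    ; fE = fE g ∘ fE f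
    ; src-pres = λ e → trans (src-pres g (fE f e)) (cong (fV g) (src-pres f e))
    ; tgt-pres = λ e → trans (tgt-pres g (fE f e)) (cong (fV g) (tgt-pres f e))
    ; lV-pres = λ v → trans (lV-pres g (fV f v)) (lV-pres f v)
    ; lE-pres = λ e → trans (lE-pres g (fE f e)) (lE-pres f e)
    }

  IsInjective : {G H : Graph Lab} → Hom G H → Set
  IsInjective f = Injective _≡_ _≡_ (fV f) × Injective _≡_ _≡_ (fE f)

  ∅G : Graph Lab
  ∅G = record { nV = 0 ; nE = 0 ; src = λ () ; tgt = λ () ; lV = λ () ; lE = λ () }

  initHom : (G : Graph Lab) → Hom ∅G G
  initHom G = record { fV = λ () ; fE = λ () ; src-pres = λ () ; tgt-pres = λ ()
                     ; lV-pres = λ () ; lE-pres = λ () }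

  IsPushout : {A B C D : Graph Lab} (f : Hom A B) (g : Hom A C)
              (f' : Hom B D) (g' : Hom C D) → Set
  IsPushout {A} {B} {C} {D} f g f' g' =
    ((f' ∘H f) ≈ (g' ∘H g)) ×
    (∀ (X : Graph Lab) (h : Hom B X) (k : Hom C X) → (h ∘H f) ≈ (k ∘H g) →
       Σ[ u ∈ Hom D X ] (((u ∘H f') ≈ h) × ((u ∘H g') ≈ k) ×
         (∀ (u' : Hom D X) → (u' ∘H f') ≈ h → (u' ∘H g') ≈ k → u' ≈ u)))

  data Cond : Graph Lab → Set where
    tt  : ∀ {P} → Cond P
    ex  : ∀ {P C} (a : Hom P C) → IsInjective a → Cond C → Cond P
    neg : ∀ {P} → Cond P → Cond P
    _∧C_ : ∀ {P} → Cond P → Cond P → Cond P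

  Sat : {P G : Graph Lab} → Cond P → Hom P G → Set
  Sat tt p = ⊤
  Sat {G = G} (ex {C = C} a _ c) p =
    Σ[ q ∈ Hom C G ] (IsInjective q × ((q ∘H a) ≈ p) × Sat c q)
  Sat (neg c) p = ¬ Sat c p
  Sat (c ∧C d) p = Sat c p × Sat d p

  Constraint : Set
  Constraint = Cond ∅G

  _⊨_ : Graph Lab → Constraint → Set
  G ⊨ c = Sat c (initHom G)

  record Rule : Set where
    field
      L K R : Graph Lab
      l : Hom K L
      r : Hom K R
      l-inj : IsInjective l
      r-inj : IsInjective r
      ac : Cond L
  open Rule public

  DPO : {L K R : Graph Lab} (l : Hom K L) (r : Hom K R) →
        (ok : {G : Graph Lab} → Hom L G → Set) → Graph Lab → Graph Lab → Set
  DPO {L} {K} {R} l r ok G H =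
    Σ[ m ∈ Hom L G ] (ok m ×
    Σ[ D ∈ Graph Lab ] Σ[ k ∈ Hom K D ] Σ[ g ∈ Hom D G ]
    Σ[ n ∈ Hom R H ] Σ[ h ∈ Hom D H ]
      (IsPushout l k m g × IsPushout r k n h))

  GTS : Set
  GTS = List Rule

-- relabelling (used to view graphs/conditions over Λ as over Λ ⊎ Q)

module _ {A B : Set} (f : A → B) where

  mapGraph : Graph A → Graph B
  mapGraph G = record { nV = nV G ; nE = nE G ; src = src G ; tgt = tgt G
                      ; lV = f ∘ lV G ; lE = f ∘ lE G }

  mapHom : {G H : Graph A} → Hom G H → Hom (mapGraph G) (mapGraph H)
  mapHom h = record { fV = fV h ; fE = fE h ; src-pres = src-pres h ; tgt-pres = tgt-pres h
                    ; lV-pres = λ v → cong f (lV-pres h v)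
                    ; lE-pres = λ e → cong f (lE-pres h e) }

  mapCond : {P : Graph A} → Cond P → Cond (mapGraph P)
  mapCond tt = tt
  mapCond (ex a (iV , iE) c) = ex (mapHom a) (iV , iE) (mapCond c)
  mapCond (neg c) = neg (mapCond c)
  mapCond (c ∧C d) = mapCond c ∧C mapCond d

-- ⟨G , x⟩ : G plus one new isolated node labelled x (the new node is index zero)
addNode : {Lab : Set} → Graph Lab → Lab → Graph Lab
addNode G x = record { nV = Data.Nat.suc (nV G) ; nE = nE G
                     ; src = suc ∘ src G ; tgt = suc ∘ tgt G
                     ; lV = λ { zero → x ; (suc v) → lV G v } ; lE = lE G }

ιHom : {Lab : Set} (G : Graph Lab) (x : Lab) → Hom G (addNode G x)
ιHom G x = record { fV = suc ; fE = id ; src-pres = λ _ → refl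
                  ; tgt-pres = λ _ → refl
                  ; lV-pres = λ _ → refl
                  ; lE-pres = λ _ → refl }

module _ {Λ : Set} where

  record RegAut (S E : GTS {Λ}) : Set where
    field
      k   : ℕ                         -- Q = Fin k  (finite, disjoint from Λ:
                                      -- graph labels are taken in Λ ⊎ Q)
      q₀  : Fin k
      δ   : Fin k → Fin k → Bool      -- δ ⊆ Q × Q  (⟨q,q'⟩ ∈ δ iff δ q q' ≡ true)
      sel : (q q' : Fin k) → δ q q' ≡ true → List (Rule {Λ})
      sel⊆ : ∀ q q' (t : δ q q' ≡ true) (ρ : Rule {Λ}) →
             ρ ∈ sel q q' t → (ρ ∈ S) ⊎ (ρ ∈ E)
  open RegAut public

  module _ {S E : GTS {Λ}} (A : RegAut S E) where

    Q : Set
    Q = Fin (k A)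

    Lab : Set
    Lab = Λ ⊎ Q

    emb : Graph Λ → Graph Lab
    emb = mapGraph inj₁

    ⟨_,_⟩ : Graph Λ → Q → Graph Lab
    ⟨ G , q ⟩ = addNode (emb G) (inj₂ q)

    _⊨Λ_ : Graph Lab → Constraint {Λ} → Set
    G ⊨Λ c = Sat (mapCond inj₁ c) init
      where
      init : Hom (mapGraph inj₁ ∅G) G
      init = record { fV = λ () ; fE = λ () ; src-pres = λ () ; tgt-pres = λ ()
                    ; lV-pres = λ () ; lE-pres = λ () }

    -- application of the enriched rule  ⟨⟨L,q⟩ ↩ K ↪ ⟨R,q'⟩ , ac⟩ of ρ;
    -- the application condition ac (over L) is checked on the match
    -- restricted to L ⊆ ⟨L,q⟩ (i.e. ac shifted along the inclusion)
    EnrichedStep : Rule {Λ} → Q → Q → Graph Lab → Graph Lab → Set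
    EnrichedStep ρ q q' =
      DPO (ιHom (emb (L ρ)) (inj₂ q) ∘H mapHom inj₁ (l ρ))
          (ιHom (emb (R ρ)) (inj₂ q') ∘H mapHom inj₁ (r ρ))
          (λ m → IsInjective m × Sat (mapCond inj₁ (ac ρ)) (m ∘H ιHom (emb (L ρ)) (inj₂ q)))

    Step : GTS {Λ} → Graph Lab → Graph Lab → Set
    Step 𝓡 G H = Σ[ q ∈ Q ] Σ[ q' ∈ Q ] Σ[ t ∈ δ A q q' ≡ true ] Σ[ ρ ∈ Rule {Λ} ]
                   (ρ ∈ 𝓡 × ρ ∈ sel A q q' t × EnrichedStep ρ q q' G H)

    StepS StepE StepSE : Graph Lab → Graph Lab → Set
    StepS = Step S
    StepE = Step E
    StepSE G H = StepS G H ⊎ StepE G H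

    CorrectS : Constraint {Λ} → Constraint {Λ} → Set
    CorrectS c d = ∀ (G' : Graph Λ) (H : Graph Lab) →
      ⟨ G' , q₀ A ⟩ ⊨Λ c → TransClosure StepS ⟨ G' , q₀ A ⟩ H → H ⊨Λ d

    CondR : Constraint {Λ} → Constraint {Λ} → Set
    CondR c d = ∀ (G' : Graph Λ) (M N H H' : Graph Lab) →
      ⟨ G' , q₀ A ⟩ ⊨Λ c →
      Star StepSE ⟨ G' , q₀ A ⟩ M → StepE M N → TransClosure StepS N H → StepE H H' →
      H ⊨Λ d

    CondR' : Constraint {Λ} → Constraint {Λ} → Set
    CondR' c d = ∀ (G' : Graph Λ) (N H H' : Graph Lab) →
      ⟨ G' , q₀ A ⟩ ⊨Λ c →
      Star StepSE ⟨ G' , q₀ A ⟩ N → StepS N H → StepE H H' →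
      H ⊨Λ d

    LastMinuteCorrect : Constraint {Λ} → Constraint {Λ} → Set
    LastMinuteCorrect c d = CorrectS c d × CondR c d

-- An 𝓢𝓔-derivation followed by an 𝓢_A-step either consists of 𝓢_A-steps only,
-- so (S) covers it, or it can be cut after its last 𝓔_A-step, which yields an
-- instance of (R). Conversely, the 𝓢_A⁺-segment of an (R)-sequence splits off
-- its last step, and everything before that step is an 𝓢𝓔-derivation, giving an
-- instance of (R').
module Submission where

open import Defs
open import Data.Product using (_×_; Σ-syntax; _,_)
open import Data.Empty using (⊥)
open import Data.Sum using (_⊎_; inj₁; inj₂)
open import Data.List.Membership.Propositional using (_∈_)
open import Function.Bundles using (_⇔_; mk⇔)
open import Level using (Level)
open import Relation.Binary.Core using (Rel)
open import Relation.Binary.Construct.Union using (_∪_)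
open import Relation.Binary.Construct.Closure.ReflexiveTransitive
  using (Star; ε; _◅_; _◅◅_; map)
open import Relation.Binary.Construct.Closure.Transitive using (TransClosure; [_]; _∷_)

module _ {a ℓ : Level} {X : Set a} {R : Rel X ℓ} where

  unsnoc⁺ : ∀ {x y} → TransClosure R x y → Σ[ z ∈ X ] (Star R x z × R z y)
  unsnoc⁺ [ x∼y ] = _ , ε , x∼y
  unsnoc⁺ (x∼w ∷ w∼⁺y) with unsnoc⁺ w∼⁺y
  ... | z , w∼⋆z , z∼y = z , x∼w ◅ w∼⋆z , z∼y

module _ {a ℓ₁ ℓ₂ : Level} {X : Set a} {P : Rel X ℓ₁} {Q : Rel X ℓ₂} where

  split-at-last-Q : ∀ {x y z} → Star (P ∪ Q) x y → TransClosure P y z →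
    TransClosure P x z ⊎
    Σ[ m ∈ X ] Σ[ n ∈ X ] (Star (P ∪ Q) x m × Q m n × TransClosure P n z)
  split-at-last-Q ε y⟶⁺z = inj₁ y⟶⁺z
  split-at-last-Q (step ◅ steps) y⟶⁺z with split-at-last-Q steps y⟶⁺z
  ... | inj₂ (m , n , w⟶⋆m , m⟶n , n⟶⁺z) = inj₂ (m , n , step ◅ w⟶⋆m , m⟶n , n⟶⁺z)
  split-at-last-Q (inj₁ x⟶w ◅ _) _ | inj₁ w⟶⁺z = inj₁ (x⟶w ∷ w⟶⁺z)
  split-at-last-Q (inj₂ x⟶w ◅ _) _ | inj₁ w⟶⁺z = inj₂ (_ , _ , ε , x⟶w , w⟶⁺z)

mainTheorem6 : {Λ : Set} (S E : GTS {Λ}) →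
    (∀ (ρ : Rule {Λ}) → ρ ∈ S → ρ ∈ E → ⊥) →
    (A : RegAut S E) (c d : Constraint {Λ}) →
    LastMinuteCorrect A c d ⇔ (CorrectS A c d × CondR' A c d)
mainTheorem6 S E _ A c d = mk⇔ to from
  where
  to : LastMinuteCorrect A c d → CorrectS A c d × CondR' A c d
  to (correctS , condR) = correctS , condR'
    where
    condR' : CondR' A c d
    condR' G' N H H' G⊨c G⟶⋆N N⟶H H⟶H' with split-at-last-Q G⟶⋆N [ N⟶H ]
    ... | inj₁ G⟶⁺H = correctS G' H G⊨c G⟶⁺H
    ... | inj₂ (M , N₁ , G⟶⋆M , M⟶N₁ , N₁⟶⁺H) =
      condR G' M N₁ H H' G⊨c G⟶⋆M M⟶N₁ N₁⟶⁺H H⟶H'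

  from : CorrectS A c d × CondR' A c d → LastMinuteCorrect A c d
  from (correctS , condR') = correctS , condR
    where
    condR : CondR A c d
    condR G' M N H H' G⊨c G⟶⋆M M⟶N N⟶⁺H H⟶H' with unsnoc⁺ N⟶⁺H
    ... | N₁ , N⟶⋆N₁ , N₁⟶H =
      condR' G' N₁ H H' G⊨c (G⟶⋆M ◅◅ inj₂ M⟶N ◅ map inj₁ N⟶⋆N₁) N₁⟶H H⟶H'
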